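{- Let $\Phi$ be a derivation in system $\mathcal{N}$ of $\Gamma \vdash^{(m,e,s)} t : \sigma$, and suppose $\Phi$ is tight. Then there exists a term $p \in \mathsf{no}_{n}$ such that $t \to_{n}^{(m,e)} p$, i.e.\ $t$ reduces to $p$ by $\to_n$ using exactly $m$ multiplicative steps and exactly $e$ exponential steps, and $|p|_{n} = s$.
   Context: Terms. Fix a countably infinite set of variables. Terms are $t,u,r ::= x \mid \lambda x.t \mid t\,u \mid t[x\backslash u]$, where $t[x\backslash u]$ (an explicit substitution) binds $x$ in $t$; terms are taken modulo $\alpha$-conversion and $t\{x:=u\}$ denotes capture-avoiding meta-level substitution. List contexts are $L ::= \square \mid L[x\backslash t]$, and $L\langle t\rangle$ is the result of plugging $t$ into the hole. CBN neutral and normal terms: $\mathsf{ne}_n ::= x \mid \mathsf{ne}_n\, t$ and $\mathsf{no}_n ::= \lambda x.\mathsf{no}_n \mid \mathsf{ne}_n$. The $n$-size is $|x|_n=0$, $|\lambda x.t|_n = |t|_n+1$, $|t\,u|_n = |t|_n+1$, $|t[x\backslash u]|_n = |t|_n$. Reduction. Rule $\mathtt{dB}$: $(L\langle \lambda x.t\rangle)\,u \mapsto L\langle t[x\backslash u]\rangle$; rule $\mathtt{sn}$: $t[x\backslash u] \mapsto t\{x:=u\}$. CBN contexts are $N ::= \square \mid N\,t \mid \lambda x.N \mid N[x\backslash u]$, and $\to_n$ is the closure of $\mathtt{dB}\cup\mathtt{sn}$ under CBN contexts. $\mathtt{dB}$-steps are multiplicative ($m$-steps), $\mathtt{sn}$-steps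 are exponential ($e$-steps). $t \to_n^{(m,e)} p$ means $t$ reduces to $p$ in finitely many $\to_n$ steps, exactly $m$ of which are $m$-steps and $e$ of which are $e$-steps. Types. Tight types: $\mathtt{tt} ::= \mathtt{n} \mid \mathtt{a}$. Types: $\sigma,\tau ::= \mathtt{tt} \mid \mathcal{M} \mid \mathcal{M}\to\sigma$, where multitypes $\mathcal{M} = [\sigma_i]_{i\in I}$ are finite multisets of types ($[\,]$ empty, $\sqcup$ union). A typing context $\Gamma$ maps variables to multitypes, $[\,]$ for all but finitely many; $\mathrm{dom}(\Gamma)=\{x \mid \Gamma(x)\neq[\,]\}$; $(\Gamma+\Delta)(x) = \Gamma(x)\sqcup\Delta(x)$, extended to finite sums $+_{i\in I}\Gamma_i$ (the empty context if $I=\emptyset$); $\Gamma\setminus\!\!\setminus x$ maps $x$ to $[\,]$ and agrees with $\Gamma$ elsewhere; $\Gamma; x:\mathcal{M}$ is the context mapping $x$ to $\mathcal{M}$ and agreeing with $\Gamma$ elsewhere, where $x\notin\mathrm{dom}(\Gamma)$. Judgements $\Gamma \vdash^{(m,e,s)} t:\sigma$ carry natural-number counters. System $\mathcal{N}$ consists of the rules: (app$_p$) from $\Gamma\vdash^{(m,e,s)} t:\mathtt{n}$ infer $\Gamma\vdash^{(m,e,s+1)} t\,u:\mathtt{n}$; (abs$_p$) from $\Gamma\vdash^{(m,e,s)} t:\mathtt{tt}$ (a tight type) with $\Gamma(x)$ tight, infer $\Gamma\setminus\!\!\setminus x\vdash^{(m,e,s+1)}\lambda x.t:\mathtt{a}$;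 (var$_c$) $x:[\sigma]\vdash^{(0,0,0)} x:\sigma$; (abs$_c$) from $\Gamma\vdash^{(m,e,s)} t:\tau$ infer $\Gamma\setminus\!\!\setminus x\vdash^{(m,e,s)}\lambda x.t:\Gamma(x)\to\tau$; (app$_c$) from $\Gamma\vdash^{(m,e,s)} t:[\sigma_i]_{i\in I}\to\tau$ and $\Delta_i\vdash^{(m_i,e_i,s_i)} u:\sigma_i$ for each $i\in I$, infer $\Gamma+_{i\in I}\Delta_i\vdash^{(1+m+\sum_i m_i,\,1+e+\sum_i e_i,\,s+\sum_i s_i)} t\,u:\tau$; (es$_c$) from $\Gamma;x:[\sigma_i]_{i\in I}\vdash^{(m,e,s)} t:\tau$ and $\Delta_i\vdash^{(m_i,e_i,s_i)} u:\sigma_i$ for each $i\in I$, infer $(\Gamma\setminus\!\!\setminus x)+_{i\in I}\Delta_i\vdash^{(m+\sum_i m_i,\,1+e+\sum_i e_i,\,s+\sum_i s_i)} t[x\backslash u]:\tau$. A multitype is tight if all its elements are tight types; a context is tight if all multitypes it assigns are tight; a derivation of $\Gamma\vdash^{(m,e,s)} t:\sigma$ is tight if $\Gamma$ is tight and $\sigma$ is a tight type. -}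

module Defs where

open import Data.Nat using (ℕ; zero; suc; _+_; _≡ᵇ_)
open import Data.Bool using (if_then_else_)
open import Data.List using (List; []; _∷_; _++_; [_])
open import Data.List.Relation.Unary.All using (All)

-- Terms, with de Bruijn indices (terms modulo α-conversion).
-- var i ; lam t (binds index 0 in t) ; app t u ;
-- es t u  represents  t[x\u], binding index 0 in t (not in u).

data Tm : Set where
  var : ℕ → Tm
  lam : Tm → Tm
  app : Tm → Tm → Tm
  es  : Tm → Tm → Tm

ext : (ℕ → ℕ) → ℕ → ℕ
ext ρ zero    = zero
ext ρ (suc i) = suc (ρ i)

rename : (ℕ → ℕ) → Tm → Tm
rename ρ (var i)  = var (ρ i)
rename ρ (lam t)  = lam (rename (ext ρ) t)
rename ρ (app t u) = app (rename ρ t) (rename ρ u)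
rename ρ (es t u) = es (rename (ext ρ) t) (rename ρ u)

exts : (ℕ → Tm) → ℕ → Tm
exts σ zero    = var zero
exts σ (suc i) = rename suc (σ i)

subst : (ℕ → Tm) → Tm → Tm
subst σ (var i)   = σ i
subst σ (lam t)   = lam (subst (exts σ) t)
subst σ (app t u) = app (subst σ t) (subst σ u)
subst σ (es t u)  = es (subst (exts σ) t) (subst σ u)

-- t{x:=u} where x is index 0 of t
sub0 : Tm → ℕ → Tm
sub0 u zero    = u
sub0 u (suc i) = var i

_[0:=_] : Tm → Tm → Tm
t [0:= u ] = subst (sub0 u) t

data LCtx : Set where
  □     : LCtx
  _[es_] : LCtx → Tm → LCtx

len : LCtx → ℕ
len □          = 0
len (L [es s ]) = suc (len L)

plug : LCtx → Tm → Tm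
plug □          t = t
plug (L [es s ]) t = es (plug L t) s

data Kind : Set where
  mul expo : Kind

data _⟶n[_]_ : Tm → Kind → Tm → Set where
  -- dB : (L⟨λx.t⟩) u ↦ L⟨t[x\u]⟩   (u weakened past the binders of L)
  dB   : ∀ L t u → app (plug L (lam t)) u ⟶n[ mul ] plug L (es t (rename (len L +_) u))
  sn   : ∀ t u → es t u ⟶n[ expo ] (t [0:= u ])
  appL : ∀ {k t t'} u → t ⟶n[ k ] t' → app t u ⟶n[ k ] app t' u
  lamN : ∀ {k t t'} → t ⟶n[ k ] t' → lam t ⟶n[ k ] lam t'
  esL  : ∀ {k t t'} u → t ⟶n[ k ] t' → es t u ⟶n[ k ] es t' u

data Steps : ℕ → ℕ → Tm → Tm → Set where
  done  : ∀ {t} → Steps 0 0 t t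
  mstep : ∀ {m e t t' p} → t ⟶n[ mul ] t' → Steps m e t' p → Steps (suc m) e t p
  estep : ∀ {m e t t' p} → t ⟶n[ expo ] t' → Steps m e t' p → Steps m (suc e) t p

data Ne : Tm → Set
data No : Tm → Set

data Ne where
  ne-var : ∀ i → Ne (var i)
  ne-app : ∀ {t} u → Ne t → Ne (app t u)

data No where
  no-lam : ∀ {t} → No t → No (lam t)
  no-ne  : ∀ {t} → Ne t → No t

size : Tm → ℕ
size (var i)   = 0
size (lam t)   = suc (size t)
size (app t u) = suc (size t)
size (es t u)  = size t

-- Types; multitypes are represented by lists, considered up to
-- permutation (recursively) via _≈_ / _≈M_.

data Ty : Set where
  tn ta : Ty
  mult  : List Ty → Ty
  arr   : List Ty → Ty → Ty

data Tight : Ty → Set where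
  tight-n : Tight tn
  tight-a : Tight ta

data _≈_ : Ty → Ty → Set
data _≈M_ : List Ty → List Ty → Set

data _≈_ where
  ≈n    : tn ≈ tn
  ≈a    : ta ≈ ta
  ≈mult : ∀ {M M'} → M ≈M M' → mult M ≈ mult M'
  ≈arr  : ∀ {M M' σ τ} → M ≈M M' → σ ≈ τ → arr M σ ≈ arr M' τ

data _≈M_ where
  []≈  : [] ≈M []
  ∷≈   : ∀ {σ τ xs ys zs} → σ ≈ τ → xs ≈M (ys ++ zs) → (σ ∷ xs) ≈M (ys ++ τ ∷ zs)

Ctx : Set
Ctx = ℕ → List Ty

∅ : Ctx
∅ _ = []

_⊕_ : Ctx → Ctx → Ctx
(Γ ⊕ Δ) i = Γ i ++ Δ i

-- Γ \\ x  for the binder x = index 0 (indices shift down)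
tail : Ctx → Ctx
tail Γ i = Γ (suc i)

single : ℕ → Ty → Ctx
single x σ i = if i ≡ᵇ x then [ σ ] else []

TightCtx : Ctx → Set
TightCtx Γ = ∀ i → All Tight (Γ i)

data _⊢_∶_⟨_,_,_⟩ : Ctx → Tm → Ty → ℕ → ℕ → ℕ → Set
-- the family (Δᵢ ⊢ u : σᵢ)_{i∈I}; conclusion Δ = +ᵢ Δᵢ and summed counters
data Args (u : Tm) : List Ty → Ctx → ℕ → ℕ → ℕ → Set

data _⊢_∶_⟨_,_,_⟩ where
  app-p : ∀ {Γ t u m e s} → Γ ⊢ t ∶ tn ⟨ m , e , s ⟩
        → Γ ⊢ app t u ∶ tn ⟨ m , e , suc s ⟩
  abs-p : ∀ {Γ t τ m e s} → Γ ⊢ t ∶ τ ⟨ m , e , s ⟩ → Tight τ → All Tight (Γ 0)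
        → tail Γ ⊢ lam t ∶ ta ⟨ m , e , suc s ⟩
  var-c : ∀ x σ → single x σ ⊢ var x ∶ σ ⟨ 0 , 0 , 0 ⟩
  abs-c : ∀ {Γ t τ m e s} → Γ ⊢ t ∶ τ ⟨ m , e , s ⟩
        → tail Γ ⊢ lam t ∶ arr (Γ 0) τ ⟨ m , e , s ⟩
  app-c : ∀ {Γ Δ t u M σs τ m e s mi ei si}
        → Γ ⊢ t ∶ arr M τ ⟨ m , e , s ⟩ → Args u σs Δ mi ei si → M ≈M σs
        → (Γ ⊕ Δ) ⊢ app t u ∶ τ ⟨ suc (m + mi) , suc (e + ei) , s + si ⟩
  es-c  : ∀ {Γ Δ t u σs τ m e s mi ei si}
        → Γ ⊢ t ∶ τ ⟨ m , e , s ⟩ → Args u σs Δ mi ei si → Γ 0 ≈M σs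
        → (tail Γ ⊕ Δ) ⊢ es t u ∶ τ ⟨ m + mi , suc (e + ei) , s + si ⟩

data Args u where
  nil  : Args u [] ∅ 0 0 0
  cons : ∀ {Γ Δ σ σs m e s m' e' s'} → Γ ⊢ u ∶ σ ⟨ m , e , s ⟩ → Args u σs Δ m' e' s'
       → Args u (σ ∷ σs) (Γ ⊕ Δ) (m + m') (e + e') (s + s')

{-# OPTIONS --safe #-}
-- A tight derivation for a CBN-normal term has counters (0, 0, |t|ₙ),
-- and each ⟶n-step out of a typed term yields a typing of the reduct with the same context, type
-- and size counter, where a dB-step lowers m by exactly one and an sn-step lowers e by exactly one.
-- A term that is not normal always has a ⟶n-step, so stepping until the counters are exhausted
-- produces the normal form. Subject reduction for sn distributes the typings of u among the
-- occurrences of x, which only works up to permutation of multitypes; it is therefore proved for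
-- the variant of 𝒩 closed under such permutations, into which 𝒩 embeds.
module Submission where

open import Defs
open import Algebra.Bundles using (CommutativeMonoid)
import Algebra.Properties.CommutativeSemigroup as CommSemigroupProperties
open import Data.Bool using (true; false)
open import Data.Empty using (⊥-elim)
open import Data.List using (List; []; _∷_; _++_; [_])
open import Data.List.Relation.Binary.Permutation.Propositional as ↭ using (_↭_)
import Data.List.Relation.Binary.Permutation.Propositional.Properties as ↭ₚ
open import Data.List.Relation.Unary.All using (All; []; _∷_)
open import Data.List.Relation.Unary.All.Properties using (++⁺; ++⁻ˡ)
open import Data.Nat using (ℕ; zero; suc; _+_; _≡ᵇ_)
open import Data.Nat.Properties using (+-assoc; +-suc; +-identityʳ; +-commutativeSemigroup; _≟_)
open import Data.Product using (∃; ∃₂; _×_; _,_)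
open import Data.Sum using (_⊎_; inj₁; inj₂)
open import Relation.Binary.PropositionalEquality as ≡ using (_≡_; refl; cong; cong₂)
open import Relation.Nullary using (¬_; yes; no)

private
  module ++ₚ = CommSemigroupProperties
    (CommutativeMonoid.commutativeSemigroup (↭ₚ.++-commutativeMonoid {A = Ty}))
  module +ₚ = CommSemigroupProperties +-commutativeSemigroup

infix 4 _≃_ _∼_ _≋_

data _≃_ : Ty → Ty → Set
data _∼_ : List Ty → List Ty → Set

data _≃_ where
  tn≃   : tn ≃ tn
  ta≃   : ta ≃ ta
  mult≃ : ∀ {M N} → M ∼ N → mult M ≃ mult N
  arr≃  : ∀ {M N σ τ} → M ∼ N → σ ≃ τ → arr M σ ≃ arr N τ

data _∼_ where
  []    : [] ∼ []
  _∷_   : ∀ {σ τ M N} → σ ≃ τ → M ∼ N → σ ∷ M ∼ τ ∷ N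
  swap  : ∀ {σ τ M} → σ ∷ τ ∷ M ∼ τ ∷ σ ∷ M
  trans : ∀ {M N K} → M ∼ N → N ∼ K → M ∼ K

infixr 5 _∷_

≃-refl : ∀ {σ} → σ ≃ σ
∼-refl : ∀ {M} → M ∼ M
≃-refl {tn}      = tn≃
≃-refl {ta}      = ta≃
≃-refl {mult M}  = mult≃ ∼-refl
≃-refl {arr M σ} = arr≃ ∼-refl ≃-refl
∼-refl {[]}    = []
∼-refl {σ ∷ M} = ≃-refl ∷ ∼-refl

≃-sym : ∀ {σ τ} → σ ≃ τ → τ ≃ σ
∼-sym : ∀ {M N} → M ∼ N → N ∼ M
≃-sym tn≃        = tn≃
≃-sym ta≃        = ta≃
≃-sym (mult≃ p)  = mult≃ (∼-sym p)
≃-sym (arr≃ p q) = arr≃ (∼-sym p) (≃-sym q)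
∼-sym []          = []
∼-sym (p ∷ ps)    = ≃-sym p ∷ ∼-sym ps
∼-sym swap        = swap
∼-sym (trans p q) = trans (∼-sym q) (∼-sym p)

↭⇒∼ : ∀ {M N} → M ↭ N → M ∼ N
↭⇒∼ ↭.refl          = ∼-refl
↭⇒∼ (↭.prep _ p)    = ≃-refl ∷ ↭⇒∼ p
↭⇒∼ (↭.swap _ _ p)  = trans swap (≃-refl ∷ ≃-refl ∷ ↭⇒∼ p)
↭⇒∼ (↭.trans p q)   = trans (↭⇒∼ p) (↭⇒∼ q)

∼-++⁺ˡ : ∀ M {N N'} → N ∼ N' → M ++ N ∼ M ++ N'
∼-++⁺ˡ []      p = p
∼-++⁺ˡ (σ ∷ M) p = ≃-refl ∷ ∼-++⁺ˡ M p

∼-++⁺ʳ : ∀ {M M'} N → M ∼ M' → M ++ N ∼ M' ++ N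
∼-++⁺ʳ N []          = ∼-refl
∼-++⁺ʳ N (p ∷ ps)    = p ∷ ∼-++⁺ʳ N ps
∼-++⁺ʳ N swap        = swap
∼-++⁺ʳ N (trans p q) = trans (∼-++⁺ʳ N p) (∼-++⁺ʳ N q)

∼-++⁺ : ∀ {M M' N N'} → M ∼ M' → N ∼ N' → M ++ N ∼ M' ++ N'
∼-++⁺ {M' = M'} {N} p q = trans (∼-++⁺ʳ N p) (∼-++⁺ˡ M' q)

≃-tight : ∀ {σ τ} → σ ≃ τ → Tight σ → Tight τ
≃-tight tn≃ t = t
≃-tight ta≃ t = t

∼-all-tight : ∀ {M N} → M ∼ N → All Tight M → All Tight N
∼-all-tight []          []       = []
∼-all-tight (p ∷ ps)    (t ∷ ts) = ≃-tight p t ∷ ∼-all-tight ps ts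
∼-all-tight swap        (t ∷ t' ∷ ts) = t' ∷ t ∷ ts
∼-all-tight (trans p q) ts       = ∼-all-tight q (∼-all-tight p ts)

≈⇒≃  : ∀ {σ τ} → σ ≈ τ → σ ≃ τ
≈M⇒∼ : ∀ {M N} → M ≈M N → M ∼ N
≈⇒≃ ≈n          = tn≃
≈⇒≃ ≈a          = ta≃
≈⇒≃ (≈mult p)   = mult≃ (≈M⇒∼ p)
≈⇒≃ (≈arr p q)  = arr≃ (≈M⇒∼ p) (≈⇒≃ q)
≈M⇒∼ []≈ = []
≈M⇒∼ (∷≈ {ys = ys} {zs} p ps) =
  trans (≈⇒≃ p ∷ ≈M⇒∼ ps) (↭⇒∼ (↭.↭-sym (↭ₚ.shift _ ys zs)))

_≋_ : Ctx → Ctx → Set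
Γ ≋ Δ = ∀ i → Γ i ∼ Δ i

≋-refl : ∀ {Γ} → Γ ≋ Γ
≋-refl i = ∼-refl

≋-trans : ∀ {Γ Δ Θ} → Γ ≋ Δ → Δ ≋ Θ → Γ ≋ Θ
≋-trans p q i = trans (p i) (q i)

⊕-identityʳ : ∀ Γ → Γ ⊕ ∅ ≋ Γ
⊕-identityʳ Γ i = ↭⇒∼ (↭ₚ.++-identityʳ (Γ i))

single-≃ : ∀ x {σ τ} → σ ≃ τ → single x σ ≋ single x τ
single-≃ x p i with i ≡ᵇ x
... | true  = p ∷ []
... | false = []

single-at : ∀ x {σ} → single x σ x ≡ [ σ ]
single-at zero    = refl
single-at (suc x) = single-at x

single-off : ∀ x k {σ} → ¬ x ≡ k → single x σ k ≡ []
single-off zero    zero    x≢k = ⊥-elim (x≢k refl)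
single-off zero    (suc k) x≢k = refl
single-off (suc x) zero    x≢k = refl
single-off (suc x) (suc k) x≢k = single-off x k (λ x≡k → x≢k (cong suc x≡k))

infix 3 _⊩_∶_⟨_,_,_⟩

data _⊩_∶_⟨_,_,_⟩ : Ctx → Tm → Ty → ℕ → ℕ → ℕ → Set
data Arg (u : Tm) : List Ty → Ctx → ℕ → ℕ → ℕ → Set

-- 𝒩 with every conclusion context taken up to ≋ and every multitype side condition up to ∼.
data _⊩_∶_⟨_,_,_⟩ where
  var-c  : ∀ {Θ} x σ → Θ ≋ single x σ → Θ ⊩ var x ∶ σ ⟨ 0 , 0 , 0 ⟩
  app-p  : ∀ {Γ t u m e s} → Γ ⊩ t ∶ tn ⟨ m , e , s ⟩ → Γ ⊩ app t u ∶ tn ⟨ m , e , suc s ⟩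
  abs-p  : ∀ {Θ Γ t τ m e s} → Γ ⊩ t ∶ τ ⟨ m , e , s ⟩ → Tight τ → All Tight (Γ 0) → Θ ≋ tail Γ
         → Θ ⊩ lam t ∶ ta ⟨ m , e , suc s ⟩
  abs-c  : ∀ {Θ Γ t M τ m e s} → Γ ⊩ t ∶ τ ⟨ m , e , s ⟩ → M ∼ Γ 0 → Θ ≋ tail Γ
         → Θ ⊩ lam t ∶ arr M τ ⟨ m , e , s ⟩
  app-c  : ∀ {Θ Γ Δ t u M σs τ m e s mi ei si} → Γ ⊩ t ∶ arr M τ ⟨ m , e , s ⟩ → Arg u σs Δ mi ei si
         → M ∼ σs → Θ ≋ Γ ⊕ Δ → Θ ⊩ app t u ∶ τ ⟨ suc (m + mi) , suc (e + ei) , s + si ⟩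
  es-c   : ∀ {Θ Γ Δ t u σs τ m e s mi ei si} → Γ ⊩ t ∶ τ ⟨ m , e , s ⟩ → Arg u σs Δ mi ei si
         → Γ 0 ∼ σs → Θ ≋ tail Γ ⊕ Δ → Θ ⊩ es t u ∶ τ ⟨ m + mi , suc (e + ei) , s + si ⟩

data Arg u where
  nil  : ∀ {Θ} → Θ ≋ ∅ → Arg u [] Θ 0 0 0
  cons : ∀ {Θ Γ Δ σ σs m e s m' e' s'} → Γ ⊩ u ∶ σ ⟨ m , e , s ⟩ → Arg u σs Δ m' e' s'
       → Θ ≋ Γ ⊕ Δ → Arg u (σ ∷ σs) Θ (m + m') (e + e') (s + s')

⊢⇒⊩ : ∀ {Γ t σ m e s} → Γ ⊢ t ∶ σ ⟨ m , e , s ⟩ → Γ ⊩ t ∶ σ ⟨ m , e , s ⟩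
Args⇒Arg : ∀ {u σs Δ m e s} → Args u σs Δ m e s → Arg u σs Δ m e s
⊢⇒⊩ (app-p D)      = app-p (⊢⇒⊩ D)
⊢⇒⊩ (abs-p D τ Γ₀) = abs-p (⊢⇒⊩ D) τ Γ₀ ≋-refl
⊢⇒⊩ (var-c x σ)    = var-c x σ ≋-refl
⊢⇒⊩ (abs-c D)      = abs-c (⊢⇒⊩ D) ∼-refl ≋-refl
⊢⇒⊩ (app-c D A p)  = app-c (⊢⇒⊩ D) (Args⇒Arg A) (≈M⇒∼ p) ≋-refl
⊢⇒⊩ (es-c D A p)   = es-c (⊢⇒⊩ D) (Args⇒Arg A) (≈M⇒∼ p) ≋-refl
Args⇒Arg nil        = nil ≋-refl
Args⇒Arg (cons D A) = cons (⊢⇒⊩ D) (Args⇒Arg A) ≋-refl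

≋-⊩ : ∀ {Θ Θ' t σ m e s} → Θ' ≋ Θ → Θ ⊩ t ∶ σ ⟨ m , e , s ⟩ → Θ' ⊩ t ∶ σ ⟨ m , e , s ⟩
≋-⊩ p (var-c x σ q)      = var-c x σ (≋-trans p q)
≋-⊩ p (app-p D)          = app-p (≋-⊩ p D)
≋-⊩ p (abs-p D τ Γ₀ q)   = abs-p D τ Γ₀ (≋-trans p q)
≋-⊩ p (abs-c D r q)      = abs-c D r (≋-trans p q)
≋-⊩ p (app-c D A r q)    = app-c D A r (≋-trans p q)
≋-⊩ p (es-c D A r q)     = es-c D A r (≋-trans p q)

≃-⊩ : ∀ {Γ t σ τ m e s} → σ ≃ τ → Γ ⊩ t ∶ σ ⟨ m , e , s ⟩ → Γ ⊩ t ∶ τ ⟨ m , e , s ⟩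
≃-⊩ p (var-c x σ q)           = var-c x _ (≋-trans q (single-≃ x p))
≃-⊩ tn≃ (app-p D)             = app-p D
≃-⊩ ta≃ (abs-p D τ Γ₀ q)      = abs-p D τ Γ₀ q
≃-⊩ (arr≃ p p') (abs-c D r q) = abs-c (≃-⊩ p' D) (trans (∼-sym p) r) q
≃-⊩ p (app-c D A r q)         = app-c (≃-⊩ (arr≃ ∼-refl p) D) A r q
≃-⊩ p (es-c D A r q)          = es-c (≃-⊩ p D) A r q

cast : ∀ {Γ t σ m e s m' e' s'} → m ≡ m' → e ≡ e' → s ≡ s'
     → Γ ⊩ t ∶ σ ⟨ m , e , s ⟩ → Γ ⊩ t ∶ σ ⟨ m' , e' , s' ⟩
cast refl refl refl D = D

castArg : ∀ {u σs Θ m e s m' e' s'} → m ≡ m' → e ≡ e' → s ≡ s'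
        → Arg u σs Θ m e s → Arg u σs Θ m' e' s'
castArg refl refl refl A = A

Arg-swap : ∀ {u σ τ M Θ m e s} → Arg u (σ ∷ τ ∷ M) Θ m e s → Arg u (τ ∷ σ ∷ M) Θ m e s
Arg-swap (cons {Γ = Γ₁} {m = m₁} {e₁} {s₁} D₁
            (cons {Γ = Γ₂} {Δ} {m = m₂} {e₂} {s₂} {m₃} {e₃} {s₃} D₂ A q₂) q₁) =
  castArg (+ₚ.x∙yz≈y∙xz m₂ m₁ m₃) (+ₚ.x∙yz≈y∙xz e₂ e₁ e₃) (+ₚ.x∙yz≈y∙xz s₂ s₁ s₃)
    (cons D₂ (cons D₁ A ≋-refl)
       (λ i → trans (q₁ i) (trans (∼-++⁺ˡ (Γ₁ i) (q₂ i))
                                  (↭⇒∼ (++ₚ.x∙yz≈y∙xz (Γ₁ i) (Γ₂ i) (Δ i))))))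

∼-Arg : ∀ {u σs σs' Θ m e s} → σs ∼ σs' → Arg u σs Θ m e s → Arg u σs' Θ m e s
∼-Arg []          A            = A
∼-Arg (p ∷ ps)    (cons D A q) = cons (≃-⊩ p D) (∼-Arg ps A) q
∼-Arg swap        A            = Arg-swap A
∼-Arg (trans p q) A            = ∼-Arg q (∼-Arg p A)

record ArgSplit (u : Tm) (M N : List Ty) (Θ : Ctx) (m e s : ℕ) : Set where
  constructor split
  field
    {Θ₁ Θ₂}             : Ctx
    {m₁ e₁ s₁ m₂ e₂ s₂} : ℕ
    left   : Arg u M Θ₁ m₁ e₁ s₁
    right  : Arg u N Θ₂ m₂ e₂ s₂
    Θ≋     : Θ ≋ Θ₁ ⊕ Θ₂
    m≡     : m ≡ m₁ + m₂
    e≡     : e ≡ e₁ + e₂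
    s≡     : s ≡ s₁ + s₂

Arg-++⁻ : ∀ {u} M {N Θ m e s} → Arg u (M ++ N) Θ m e s → ArgSplit u M N Θ m e s
Arg-++⁻ []      A = split (nil ≋-refl) A ≋-refl refl refl refl
Arg-++⁻ (σ ∷ M) (cons {Γ = Γ} {m = m} {e} {s} D A q) with Arg-++⁻ M A
... | split {Θ₁} {Θ₂} {m₁} {e₁} {s₁} {m₂} {e₂} {s₂} A₁ A₂ Θ≋ refl refl refl =
  split (cons D A₁ ≋-refl) A₂
    (λ i → trans (q i) (trans (∼-++⁺ˡ (Γ i) (Θ≋ i))
                              (↭⇒∼ (↭.↭-sym (↭ₚ.++-assoc (Γ i) (Θ₁ i) (Θ₂ i))))))
    (≡.sym (+-assoc m m₁ m₂)) (≡.sym (+-assoc e e₁ e₂)) (≡.sym (+-assoc s s₁ s₂))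

Arg-[]⁻ : ∀ {u Θ m e s} → Arg u [] Θ m e s → Θ ≋ ∅ × m ≡ 0 × e ≡ 0 × s ≡ 0
Arg-[]⁻ (nil q) = q , refl , refl , refl

Arg-[-]⁻ : ∀ {u σ Θ m e s} → Arg u [ σ ] Θ m e s → ∃ λ Γ → Γ ⊩ u ∶ σ ⟨ m , e , s ⟩ × Θ ≋ Γ
Arg-[-]⁻ (cons {Γ = Γ} {m = m} {e} {s} D (nil q₀) q) =
  Γ , cast (≡.sym (+-identityʳ m)) (≡.sym (+-identityʳ e)) (≡.sym (+-identityʳ s)) D
    , λ i → trans (q i) (trans (∼-++⁺ˡ (Γ i) (q₀ i)) (⊕-identityʳ Γ i))

-- the renaming that skips index k
wkVar : ℕ → ℕ → ℕ
wkVar zero    = suc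
wkVar (suc k) = ext (wkVar k)

insertAt : ℕ → Ctx → Ctx
insertAt zero    Γ zero    = []
insertAt zero    Γ (suc j) = Γ j
insertAt (suc k) Γ zero    = Γ 0
insertAt (suc k) Γ (suc j) = insertAt k (tail Γ) j

insertAt-⊕ : ∀ k Γ Δ → insertAt k (Γ ⊕ Δ) ≋ insertAt k Γ ⊕ insertAt k Δ
insertAt-⊕ zero    Γ Δ zero    = []
insertAt-⊕ zero    Γ Δ (suc i) = ∼-refl
insertAt-⊕ (suc k) Γ Δ zero    = ∼-refl
insertAt-⊕ (suc k) Γ Δ (suc i) = insertAt-⊕ k (tail Γ) (tail Δ) i

insertAt-≋ : ∀ k {Γ Δ} → Γ ≋ Δ → insertAt k Γ ≋ insertAt k Δ
insertAt-≋ zero    p zero    = []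
insertAt-≋ zero    p (suc i) = p i
insertAt-≋ (suc k) p zero    = p 0
insertAt-≋ (suc k) p (suc i) = insertAt-≋ k (λ j → p (suc j)) i

insertAt-∅ : ∀ k → insertAt k ∅ ≋ ∅
insertAt-∅ zero    zero    = []
insertAt-∅ zero    (suc i) = []
insertAt-∅ (suc k) zero    = []
insertAt-∅ (suc k) (suc i) = insertAt-∅ k i

insertAt-single : ∀ k x σ → insertAt k (single x σ) ≋ single (wkVar k x) σ
insertAt-single zero    x       σ zero    = []
insertAt-single zero    x       σ (suc i) = ∼-refl
insertAt-single (suc k) zero    σ zero    = ∼-refl
insertAt-single (suc k) zero    σ (suc i) = insertAt-∅ k i
insertAt-single (suc k) (suc x) σ zero    = []
insertAt-single (suc k) (suc x) σ (suc i) = insertAt-single k x σ i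

weaken : ∀ k {Θ t σ m e s} → Θ ⊩ t ∶ σ ⟨ m , e , s ⟩
       → insertAt k Θ ⊩ rename (wkVar k) t ∶ σ ⟨ m , e , s ⟩
weakenArg : ∀ k {Θ u σs m e s} → Arg u σs Θ m e s → Arg (rename (wkVar k) u) σs (insertAt k Θ) m e s
weaken k (var-c x σ q) = var-c (wkVar k x) σ (≋-trans (insertAt-≋ k q) (insertAt-single k x σ))
weaken k (app-p D) = app-p (weaken k D)
weaken k (abs-p D τ Γ₀ q) = abs-p (weaken (suc k) D) τ Γ₀ (insertAt-≋ k q)
weaken k (abs-c D r q) = abs-c (weaken (suc k) D) r (insertAt-≋ k q)
weaken k (app-c {Γ = Γ} {Δ} D A r q) =
  app-c (weaken k D) (weakenArg k A) r (≋-trans (insertAt-≋ k q) (insertAt-⊕ k Γ Δ))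
weaken k (es-c {Γ = Γ} {Δ} D A r q) =
  es-c (weaken (suc k) D) (weakenArg k A) r (≋-trans (insertAt-≋ k q) (insertAt-⊕ k (tail Γ) Δ))
weakenArg k (nil q) = nil (≋-trans (insertAt-≋ k q) (insertAt-∅ k))
weakenArg k (cons {Γ = Γ} {Δ} D A q) =
  cons (weaken k D) (weakenArg k A) (≋-trans (insertAt-≋ k q) (insertAt-⊕ k Γ Δ))

shiftBy : ℕ → Tm → Tm
shiftBy zero    u = u
shiftBy (suc k) u = rename suc (shiftBy k u)

-- the substitution {x := u} for the variable x bound k binders further out
subAt : ℕ → Tm → ℕ → Tm
subAt zero    u = sub0 u
subAt (suc k) u = exts (subAt k u)

removeAt : ℕ → Ctx → Ctx
removeAt k Γ j = Γ (wkVar k j)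

subAt-hit : ∀ k u → subAt k u k ≡ shiftBy k u
subAt-hit zero    u = refl
subAt-hit (suc k) u = cong (rename suc) (subAt-hit k u)

subAt-miss : ∀ k u x → ¬ x ≡ k → ∃ λ y → x ≡ wkVar k y × subAt k u x ≡ var y
subAt-miss zero    u zero    x≢k = ⊥-elim (x≢k refl)
subAt-miss zero    u (suc x) x≢k = x , refl , refl
subAt-miss (suc k) u zero    x≢k = zero , refl , refl
subAt-miss (suc k) u (suc x) x≢k with subAt-miss k u x (λ x≡k → x≢k (cong suc x≡k))
... | y , refl , eq = suc y , refl , cong (rename suc) eq

single-skip : ∀ k {σ} j → single k σ (wkVar k j) ≡ []
single-skip zero    j       = refl
single-skip (suc k) zero    = refl
single-skip (suc k) (suc j) = single-skip k j

single-wkVar : ∀ k y {σ} j → single (wkVar k y) σ (wkVar k j) ≡ single y σ j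
single-wkVar zero    y       j       = refl
single-wkVar (suc k) zero    zero    = refl
single-wkVar (suc k) zero    (suc j) = refl
single-wkVar (suc k) (suc y) zero    = refl
single-wkVar (suc k) (suc y) (suc j) = single-wkVar k y j

≡⇒∼ : ∀ {M N} → M ≡ N → M ∼ N
≡⇒∼ refl = ∼-refl

removeAt-⊕-interchange : ∀ k Γ Γ' Δ₁ Δ₂ {Θ Δ} → Θ ≋ Γ ⊕ Γ' → Δ ≋ Δ₁ ⊕ Δ₂
                       → removeAt k Θ ⊕ Δ ≋ (removeAt k Γ ⊕ Δ₁) ⊕ (removeAt k Γ' ⊕ Δ₂)
removeAt-⊕-interchange k Γ Γ' Δ₁ Δ₂ p q i =
  trans (∼-++⁺ (p (wkVar k i)) (q i))
        (↭⇒∼ (++ₚ.interchange (Γ (wkVar k i)) (Γ' (wkVar k i)) (Δ₁ i) (Δ₂ i)))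

-- The typings of u in the Arg family are shared out among the premises according to the
-- multitype each premise assigns to x; ∼-Arg and Arg-++⁻ perform this split.
subst-⊩ : ∀ k u {Θ t τ m e s σs Δ mi ei si} → Θ ⊩ t ∶ τ ⟨ m , e , s ⟩ → Arg (shiftBy k u) σs Δ mi ei si
        → Θ k ∼ σs → removeAt k Θ ⊕ Δ ⊩ subst (subAt k u) t ∶ τ ⟨ m + mi , e + ei , s + si ⟩
subst-Arg : ∀ k u {Ξ v ρs m e s σs Δ mi ei si} → Arg v ρs Ξ m e s → Arg (shiftBy k u) σs Δ mi ei si
          → Ξ k ∼ σs → Arg (subst (subAt k u) v) ρs (removeAt k Ξ ⊕ Δ) (m + mi) (e + ei) (s + si)
subst-⊩ k u (var-c x τ q) A h with x ≟ k
... | yes refl with Arg-[-]⁻ (∼-Arg (trans (∼-sym h) (trans (q k) (≡⇒∼ (single-at k)))) A)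
... | _ , D , r rewrite subAt-hit k u =
  ≋-⊩ (λ i → ∼-++⁺ (trans (q (wkVar k i)) (≡⇒∼ (single-skip k i))) (r i)) D
subst-⊩ k u (var-c x τ q) A h | no x≢k
  with Arg-[]⁻ (∼-Arg (trans (∼-sym h) (trans (q k) (≡⇒∼ (single-off x k x≢k)))) A)
     | subAt-miss k u x x≢k
... | r , refl , refl , refl | y , refl , eq rewrite eq =
  var-c y τ (λ i → trans (∼-++⁺ (trans (q (wkVar k i)) (≡⇒∼ (single-wkVar k y i))) (r i))
                       (⊕-identityʳ (single y τ) i))
subst-⊩ k u (app-p D) A h = app-p (subst-⊩ k u D A h)
subst-⊩ k u {Δ = Δ} (abs-p D τ Γ₀ q) A h =
  abs-p (subst-⊩ (suc k) u D (weakenArg 0 A) (trans (∼-sym (q k)) h)) τ (++⁺ Γ₀ [])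
    (λ i → ∼-++⁺ʳ (Δ i) (q (wkVar k i)))
subst-⊩ k u {Δ = Δ} (abs-c {Γ = Γ} D r q) A h =
  abs-c (subst-⊩ (suc k) u D (weakenArg 0 A) (trans (∼-sym (q k)) h))
    (trans r (∼-sym (⊕-identityʳ Γ 0))) (λ i → ∼-++⁺ʳ (Δ i) (q (wkVar k i)))
subst-⊩ k u (app-c {Γ = Γ} {Δ'} {m = m} {e} {s} {mi'} {ei'} {si'} D A' r q) A h
  with Arg-++⁻ (Γ k) (∼-Arg (trans (∼-sym h) (q k)) A)
... | split {Θ₁} {Θ₂} {m₁} {e₁} {s₁} {m₂} {e₂} {s₂} A₁ A₂ Δ≋ refl refl refl =
  cast (cong suc (+ₚ.interchange m m₁ mi' m₂)) (cong suc (+ₚ.interchange e e₁ ei' e₂))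
       (+ₚ.interchange s s₁ si' s₂)
    (app-c (subst-⊩ k u D A₁ ∼-refl) (subst-Arg k u A' A₂ ∼-refl) r
       (removeAt-⊕-interchange k Γ Δ' Θ₁ Θ₂ q Δ≋))
subst-⊩ k u (es-c {Γ = Γ} {Δ'} {m = m} {e} {s} {mi'} {ei'} {si'} D A' r q) A h
  with Arg-++⁻ (Γ (suc k)) (∼-Arg (trans (∼-sym h) (q k)) A)
... | split {Θ₁} {Θ₂} {m₁} {e₁} {s₁} {m₂} {e₂} {s₂} A₁ A₂ Δ≋ refl refl refl =
  cast (+ₚ.interchange m m₁ mi' m₂) (cong suc (+ₚ.interchange e e₁ ei' e₂))
       (+ₚ.interchange s s₁ si' s₂)
    (es-c (subst-⊩ (suc k) u D (weakenArg 0 A₁) ∼-refl) (subst-Arg k u A' A₂ ∼-refl)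
       (trans (⊕-identityʳ Γ 0) r) (removeAt-⊕-interchange k (tail Γ) Δ' Θ₁ Θ₂ q Δ≋))
subst-Arg k u (nil q) A h with Arg-[]⁻ (∼-Arg (trans (∼-sym h) (q k)) A)
... | r , refl , refl , refl = nil (λ i → ∼-++⁺ (q (wkVar k i)) (r i))
subst-Arg k u (cons {Γ = Γ} {Δ'} {m = m} {e} {s} {mi'} {ei'} {si'} D A' q) A h
  with Arg-++⁻ (Γ k) (∼-Arg (trans (∼-sym h) (q k)) A)
... | split {Θ₁} {Θ₂} {m₁} {e₁} {s₁} {m₂} {e₂} {s₂} A₁ A₂ Δ≋ refl refl refl =
  castArg (+ₚ.interchange m m₁ mi' m₂) (+ₚ.interchange e e₁ ei' e₂) (+ₚ.interchange s s₁ si' s₂)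
    (cons (subst-⊩ k u D A₁ ∼-refl) (subst-Arg k u A' A₂ ∼-refl)
       (removeAt-⊕-interchange k Γ Δ' Θ₁ Θ₂ q Δ≋))

ext-fusion : ∀ {ρ ρ' χ} → (∀ i → ρ (ρ' i) ≡ χ i) → ∀ i → ext ρ (ext ρ' i) ≡ ext χ i
ext-fusion h zero    = refl
ext-fusion h (suc i) = cong suc (h i)

rename-fusion : ∀ {ρ ρ' χ} → (∀ i → ρ (ρ' i) ≡ χ i) → ∀ t → rename ρ (rename ρ' t) ≡ rename χ t
rename-fusion h (var i)   = cong var (h i)
rename-fusion h (lam t)   = cong lam (rename-fusion (ext-fusion h) t)
rename-fusion h (app t u) = cong₂ app (rename-fusion h t) (rename-fusion h u)
rename-fusion h (es t u)  = cong₂ es (rename-fusion (ext-fusion h) t) (rename-fusion h u)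

ext-id : ∀ {ρ} → (∀ i → ρ i ≡ i) → ∀ i → ext ρ i ≡ i
ext-id h zero    = refl
ext-id h (suc i) = cong suc (h i)

rename-id : ∀ {ρ} → (∀ i → ρ i ≡ i) → ∀ t → rename ρ t ≡ t
rename-id h (var i)   = cong var (h i)
rename-id h (lam t)   = cong lam (rename-id (ext-id h) t)
rename-id h (app t u) = cong₂ app (rename-id h t) (rename-id h u)
rename-id h (es t u)  = cong₂ es (rename-id (ext-id h) t) (rename-id h u)

dB-⊩ : ∀ L {Γ Δ b u M σs τ m e s mi ei si} → Γ ⊩ plug L (lam b) ∶ arr M τ ⟨ m , e , s ⟩
     → Arg u σs Δ mi ei si → M ∼ σs
     → Γ ⊕ Δ ⊩ plug L (es b (rename (len L +_) u)) ∶ τ ⟨ m + mi , suc (e + ei) , s + si ⟩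
dB-⊩ □ {Δ = Δ} {u = u} (abs-c D r q) A h rewrite rename-id {ρ = 0 +_} (λ _ → refl) u =
  es-c D A (trans (∼-sym r) h) (λ i → ∼-++⁺ʳ (Δ i) (q i))
dB-⊩ (L [es _ ]) {Δ = Δ} {u = u} (es-c {Γ = Γ} {Δr} {m = m} {e} {s} {mr} {er} {sr} D Ar r q) A h
  rewrite ≡.sym (rename-fusion {ρ = len L +_} {suc} {suc (len L) +_} (λ i → +-suc (len L) i) u) =
  cast (+ₚ.xy∙z≈xz∙y m _ mr) (cong suc (cong suc (+ₚ.xy∙z≈xz∙y e _ er))) (+ₚ.xy∙z≈xz∙y s _ sr)
    (es-c (dB-⊩ L D (weakenArg 0 A) h) Ar (trans (⊕-identityʳ Γ 0) r)
       (λ i → trans (∼-++⁺ʳ (Δ i) (q i)) (↭⇒∼ (++ₚ.xy∙z≈xz∙y (Γ (suc i)) (Δr i) (Δ i)))))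

plug-lam-untypable-tn : ∀ L {Γ b m e s} → ¬ (Γ ⊩ plug L (lam b) ∶ tn ⟨ m , e , s ⟩)
plug-lam-untypable-tn □ ()
plug-lam-untypable-tn (L [es _ ]) (es-c D _ _ _) = plug-lam-untypable-tn L D

data Reduct : Kind → Ctx → Tm → Ty → ℕ → ℕ → ℕ → Set where
  mul-reduct  : ∀ {Γ t σ m e s} → Γ ⊩ t ∶ σ ⟨ m , e , s ⟩ → Reduct mul Γ t σ (suc m) e s
  expo-reduct : ∀ {Γ t σ m e s} → Γ ⊩ t ∶ σ ⟨ m , e , s ⟩ → Reduct expo Γ t σ m (suc e) s

subject-reduction : ∀ {t k t' Θ σ m e s} → t ⟶n[ k ] t' → Θ ⊩ t ∶ σ ⟨ m , e , s ⟩
                  → Reduct k Θ t' σ m e s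
subject-reduction (dB L _ _) (app-p D)        = ⊥-elim (plug-lam-untypable-tn L D)
subject-reduction (dB L _ _) (app-c D A h q)  = mul-reduct (≋-⊩ q (dB-⊩ L D A h))
subject-reduction (sn _ u) (es-c D A h q)     = expo-reduct (≋-⊩ q (subst-⊩ 0 u D A h))
subject-reduction (appL u st) (app-p D) with subject-reduction st D
... | mul-reduct D'  = mul-reduct (app-p D')
... | expo-reduct D' = expo-reduct (app-p D')
subject-reduction (appL u st) (app-c D A h q) with subject-reduction st D
... | mul-reduct D'  = mul-reduct (app-c D' A h q)
... | expo-reduct D' = expo-reduct (app-c D' A h q)
subject-reduction (lamN st) (abs-p D τ Γ₀ q) with subject-reduction st D
... | mul-reduct D'  = mul-reduct (abs-p D' τ Γ₀ q)
... | expo-reduct D' = expo-reduct (abs-p D' τ Γ₀ q)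
subject-reduction (lamN st) (abs-c D r q) with subject-reduction st D
... | mul-reduct D'  = mul-reduct (abs-c D' r q)
... | expo-reduct D' = expo-reduct (abs-c D' r q)
subject-reduction (esL u st) (es-c D A h q) with subject-reduction st D
... | mul-reduct D'  = mul-reduct (es-c D' A h q)
... | expo-reduct D' = expo-reduct (es-c D' A h q)

tail-tight : ∀ {Θ Γ} → TightCtx Θ → Θ ≋ tail Γ → All Tight (Γ 0) → TightCtx Γ
tail-tight tΘ q Γ₀ zero    = Γ₀
tail-tight tΘ q Γ₀ (suc i) = ∼-all-tight (q i) (tΘ i)

Ne-tight-counters : ∀ {Γ t σ m e s} → Ne t → TightCtx Γ → Γ ⊩ t ∶ σ ⟨ m , e , s ⟩
                  → Tight σ × m ≡ 0 × e ≡ 0 × s ≡ size t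
Ne-tight-counters (ne-var x) tΓ (var-c x σ q)
  with ∼-all-tight (trans (q x) (≡⇒∼ (single-at x))) (tΓ x)
... | tσ ∷ [] = tσ , refl , refl , refl
Ne-tight-counters (ne-app u ne) tΓ (app-p D) with Ne-tight-counters ne tΓ D
... | _ , m≡0 , e≡0 , s≡ = tight-n , m≡0 , e≡0 , cong suc s≡
Ne-tight-counters (ne-app u ne) tΓ (app-c {Γ = Γ} D A h q)
  with Ne-tight-counters ne (λ i → ++⁻ˡ (Γ i) (∼-all-tight (q i) (tΓ i))) D
... | () , _

No-tight-counters : ∀ {Γ t σ m e s} → No t → TightCtx Γ → Tight σ → Γ ⊩ t ∶ σ ⟨ m , e , s ⟩
                  → m ≡ 0 × e ≡ 0 × s ≡ size t
No-tight-counters (no-lam nf) tΓ tσ (abs-p D τ Γ₀ q)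
  with No-tight-counters nf (tail-tight tΓ q Γ₀) τ D
... | m≡0 , e≡0 , s≡ = m≡0 , e≡0 , cong suc s≡
No-tight-counters (no-lam nf) tΓ () (abs-c D r q)
No-tight-counters (no-ne ne) tΓ tσ D with Ne-tight-counters ne tΓ D
... | _ , counters = counters

progress : ∀ t → No t ⊎ ∃₂ λ k t' → t ⟶n[ k ] t'
progress (var i) = inj₁ (no-ne (ne-var i))
progress (lam t) with progress t
... | inj₁ nf             = inj₁ (no-lam nf)
... | inj₂ (k , t' , st)  = inj₂ (k , lam t' , lamN st)
progress (app t u) with progress t
... | inj₁ (no-lam {b} _) = inj₂ (mul , _ , dB □ b u)
... | inj₁ (no-ne ne)     = inj₁ (no-ne (ne-app u ne))
... | inj₂ (k , t' , st)  = inj₂ (k , app t' u , appL u st)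
progress (es t u) = inj₂ (expo , _ , sn t u)

Normalises : ℕ → ℕ → ℕ → Tm → Set
Normalises m e s t = ∃ λ p → No p × Steps m e t p × size p ≡ s

-- Terminates lexicographically on (m , e): every step lowers exactly one counter by one.
normalise : ∀ m e {Γ t σ s} → TightCtx Γ → Tight σ → Γ ⊩ t ∶ σ ⟨ m , e , s ⟩ → Normalises m e s t
normalise m e {t = t} tΓ tσ D with progress t
... | inj₁ nf with No-tight-counters nf tΓ tσ D
...   | refl , refl , refl = t , nf , done , refl
normalise m e tΓ tσ D | inj₂ (k , t' , st) with subject-reduction st D
... | mul-reduct {m = m'} D' with normalise m' e tΓ tσ D'
...   | p , nf , steps , size≡ = p , nf , mstep st steps , size≡
normalise m e tΓ tσ D | inj₂ (k , t' , st) | expo-reduct {e = e'} D' with normalise m e' tΓ tσ D'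
...   | p , nf , steps , size≡ = p , nf , estep st steps , size≡

theorem3p6 : ∀ {Γ t σ m e s} → Γ ⊢ t ∶ σ ⟨ m , e , s ⟩ → TightCtx Γ → Tight σ
           → ∃ λ p → No p × Steps m e t p × size p ≡ s
theorem3p6 D tΓ tσ = normalise _ _ tΓ tσ (⊢⇒⊩ D)
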